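{- Let $G_1$ and $G_2$ be non-complete graphs on disjoint vertex sets. Then $\theta_c(G_1\vee G_2)=\theta(G_1)+\theta(G_2)$.
   Context: Graphs are finite, simple, undirected. $G_1\vee G_2$ is the join: the disjoint union plus all edges between $V(G_1)$ and $V(G_2)$. A set $S\subseteq V(G)$ is a clique deletion set of $G$ if $G-S$ is a clique; it is a connected clique deletion set if moreover $G[S]$ is connected. $\theta(G)$ and $\theta_c(G)$ denote the minimum sizes of a clique deletion set and a connected clique deletion set of $G$, respectively ($\theta_c(G)=\infty$ if none exists). -}

module Defs where

open import Data.Nat using (ℕ; _+_; _≤_)
open import Data.Bool using (Bool; true; false)
open import Data.Fin using (Fin; splitAt)
open import Data.Fin.Subset using (Subset; _∈_; ∁; ∣_∣)
open import Data.Sum using (_⊎_; inj₁; inj₂)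
open import Data.Product using (Σ; ∃; _×_; _,_)
open import Relation.Binary.PropositionalEquality using (_≡_; _≢_; refl)

record Graph (n : ℕ) : Set where
  field
    adj    : Fin n → Fin n → Bool
    sym    : ∀ u v → adj u v ≡ adj v u
    irrefl : ∀ v → adj v v ≡ false
open Graph public

NonComplete : ∀ {n} → Graph n → Set
NonComplete G = ∃ λ u → ∃ λ v → u ≢ v × adj G u v ≡ false

-- The join G₁ ∨ G₂ on vertex set Fin (n + m): the first n vertices form G₁,
-- the last m form G₂, and every vertex of G₁ is adjacent to every vertex of G₂.
joinAdj : ∀ {n m} → Graph n → Graph m → Fin (n + m) → Fin (n + m) → Bool
joinAdj {n} G₁ G₂ x y with splitAt n x | splitAt n y
... | inj₁ a | inj₁ b = adj G₁ a b
... | inj₁ a | inj₂ b = true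
... | inj₂ a | inj₁ b = true
... | inj₂ a | inj₂ b = adj G₂ a b

joinSym : ∀ {n m} (G₁ : Graph n) (G₂ : Graph m) → ∀ x y → joinAdj G₁ G₂ x y ≡ joinAdj G₁ G₂ y x
joinSym {n} G₁ G₂ x y with splitAt n x | splitAt n y
... | inj₁ a | inj₁ b = sym G₁ a b
... | inj₁ a | inj₂ b = refl
... | inj₂ a | inj₁ b = refl
... | inj₂ a | inj₂ b = sym G₂ a b

joinIrrefl : ∀ {n m} (G₁ : Graph n) (G₂ : Graph m) → ∀ x → joinAdj G₁ G₂ x x ≡ false
joinIrrefl {n} G₁ G₂ x with splitAt n x
... | inj₁ a = irrefl G₁ a
... | inj₂ a = irrefl G₂ a

_∨ᴳ_ : ∀ {n m} → Graph n → Graph m → Graph (n + m)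
G₁ ∨ᴳ G₂ = record { adj = joinAdj G₁ G₂ ; sym = joinSym G₁ G₂ ; irrefl = joinIrrefl G₁ G₂ }

IsClique : ∀ {n} → Graph n → Subset n → Set
IsClique G T = ∀ u v → u ∈ T → v ∈ T → u ≢ v → adj G u v ≡ true

IsCliqueDeletionSet : ∀ {n} → Graph n → Subset n → Set
IsCliqueDeletionSet G S = IsClique G (∁ S)

data WalkIn {n} (G : Graph n) (S : Subset n) : Fin n → Fin n → Set where
  here : ∀ {u} → u ∈ S → WalkIn G S u u
  step : ∀ {u w v} → u ∈ S → adj G u w ≡ true → WalkIn G S w v → WalkIn G S u v

InducedConnected : ∀ {n} → Graph n → Subset n → Set
InducedConnected G S = ∀ u v → u ∈ S → v ∈ S → WalkIn G S u v

IsConnectedCliqueDeletionSet : ∀ {n} → Graph n → Subset n → Set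
IsConnectedCliqueDeletionSet G S = IsCliqueDeletionSet G S × InducedConnected G S

θ≡ : ∀ {n} → Graph n → ℕ → Set
θ≡ G k = (∃ λ S → IsCliqueDeletionSet G S × ∣ S ∣ ≡ k)
       × (∀ S → IsCliqueDeletionSet G S → k ≤ ∣ S ∣)

-- θ_c(G) = k (finite): some connected clique deletion set has size k,
-- and every one has size ≥ k.
θc≡ : ∀ {n} → Graph n → ℕ → Set
θc≡ G k = (∃ λ S → IsConnectedCliqueDeletionSet G S × ∣ S ∣ ≡ k)
        × (∀ S → IsConnectedCliqueDeletionSet G S → k ≤ ∣ S ∣)

{-# OPTIONS --safe #-}
module Submission where

-- A clique of G₁ ∨ G₂ is exactly the join of a clique of G₁ and a clique of G₂, so a
-- clique deletion set of the join is the union of one of G₁ and one of G₂; hence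
-- θ(G₁ ∨ G₂) = θ(G₁) + θ(G₂), and θ_c(G₁ ∨ G₂) can only be larger. Conversely, in a
-- non-complete graph every clique deletion set is nonempty, and a vertex set of the
-- join meeting both sides induces a connected subgraph: two of its vertices on the
-- same side are joined through any of its vertices on the other side. So the union of
-- minimum clique deletion sets of G₁ and G₂ is a connected one of the join.

open import Defs hiding (sym)
open import Data.Nat using (ℕ; _+_; _≤_; suc)
open import Data.Nat.Properties using (+-mono-≤)
open import Data.Bool using (true; false)
open import Data.Fin using (Fin; splitAt; _↑ˡ_; _↑ʳ_)
open import Data.Fin.Properties
  using (splitAt-↑ˡ; splitAt-↑ʳ; splitAt⁻¹-↑ˡ; splitAt⁻¹-↑ʳ; ↑ˡ-injective; ↑ʳ-injective)
open import Data.Fin.Subset using (Subset; _∈_; ∁; ∣_∣; Nonempty)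
open import Data.Fin.Subset.Properties using (_∈?_; x∉p⇒x∈∁p)
open import Data.Vec using ([]; _∷_; _++_)
import Data.Vec as Vec
open import Data.Vec.Properties using (map-++; lookup-++ˡ; lookup-++ʳ; []=⇒lookup; lookup⇒[]=)
open import Data.Sum using (inj₁; inj₂)
open import Data.Product using (_×_; _,_)
open import Relation.Nullary using (yes; no)
open import Relation.Binary.PropositionalEquality
  using (_≡_; refl; sym; trans; cong; subst)

private
  variable
    n m k : ℕ

data JoinView (n m : ℕ) : Fin (n + m) → Set where
  left  : (a : Fin n) → JoinView n m (a ↑ˡ m)
  right : (b : Fin m) → JoinView n m (n ↑ʳ b)

joinView : ∀ n m (u : Fin (n + m)) → JoinView n m u
joinView n m u with splitAt n u in eq
... | inj₁ a = subst (JoinView n m) (splitAt⁻¹-↑ˡ eq) (left a)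
... | inj₂ b = subst (JoinView n m) (splitAt⁻¹-↑ʳ eq) (right b)

module _ (p : Subset n) (q : Subset m) where

  ∈-++⁺ˡ : ∀ {a} → a ∈ p → a ↑ˡ m ∈ p ++ q
  ∈-++⁺ˡ {a} a∈p = lookup⇒[]= _ (p ++ q) (trans (lookup-++ˡ p q a) ([]=⇒lookup a∈p))

  ∈-++⁺ʳ : ∀ {b} → b ∈ q → n ↑ʳ b ∈ p ++ q
  ∈-++⁺ʳ {b} b∈q = lookup⇒[]= _ (p ++ q) (trans (lookup-++ʳ p q b) ([]=⇒lookup b∈q))

  ∈-++⁻ˡ : ∀ {a} → a ↑ˡ m ∈ p ++ q → a ∈ p
  ∈-++⁻ˡ {a} a∈p++q = lookup⇒[]= a p (trans (sym (lookup-++ˡ p q a)) ([]=⇒lookup a∈p++q))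

  ∈-++⁻ʳ : ∀ {b} → n ↑ʳ b ∈ p ++ q → b ∈ q
  ∈-++⁻ʳ {b} b∈p++q = lookup⇒[]= b q (trans (sym (lookup-++ʳ p q b)) ([]=⇒lookup b∈p++q))

  ∁-++ : ∁ (p ++ q) ≡ ∁ p ++ ∁ q
  ∁-++ = map-++ _ p q

∣p++q∣≡∣p∣+∣q∣ : (p : Subset n) (q : Subset m) → ∣ p ++ q ∣ ≡ ∣ p ∣ + ∣ q ∣
∣p++q∣≡∣p∣+∣q∣ []          q = refl
∣p++q∣≡∣p∣+∣q∣ (true ∷ p)  q = cong suc (∣p++q∣≡∣p∣+∣q∣ p q)
∣p++q∣≡∣p∣+∣q∣ (false ∷ p) q = ∣p++q∣≡∣p∣+∣q∣ p q

module _ (G₁ : Graph n) (G₂ : Graph m) where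

  ∨ᴳ-adj-↑ˡ-↑ˡ : ∀ a b → adj (G₁ ∨ᴳ G₂) (a ↑ˡ m) (b ↑ˡ m) ≡ adj G₁ a b
  ∨ᴳ-adj-↑ˡ-↑ˡ a b rewrite splitAt-↑ˡ n a m | splitAt-↑ˡ n b m = refl

  ∨ᴳ-adj-↑ˡ-↑ʳ : ∀ a b → adj (G₁ ∨ᴳ G₂) (a ↑ˡ m) (n ↑ʳ b) ≡ true
  ∨ᴳ-adj-↑ˡ-↑ʳ a b rewrite splitAt-↑ˡ n a m | splitAt-↑ʳ n m b = refl

  ∨ᴳ-adj-↑ʳ-↑ˡ : ∀ a b → adj (G₁ ∨ᴳ G₂) (n ↑ʳ a) (b ↑ˡ m) ≡ true
  ∨ᴳ-adj-↑ʳ-↑ˡ a b rewrite splitAt-↑ʳ n m a | splitAt-↑ˡ n b m = refl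

  ∨ᴳ-adj-↑ʳ-↑ʳ : ∀ a b → adj (G₁ ∨ᴳ G₂) (n ↑ʳ a) (n ↑ʳ b) ≡ adj G₂ a b
  ∨ᴳ-adj-↑ʳ-↑ʳ a b rewrite splitAt-↑ʳ n m a | splitAt-↑ʳ n m b = refl

  isClique-++⁺ : ∀ {T₁ T₂} → IsClique G₁ T₁ → IsClique G₂ T₂ →
                 IsClique (G₁ ∨ᴳ G₂) (T₁ ++ T₂)
  isClique-++⁺ {T₁} {T₂} clique₁ clique₂ u v u∈T v∈T u≢v
    with joinView n m u | joinView n m v
  ... | left a  | left b  = trans (∨ᴳ-adj-↑ˡ-↑ˡ a b)
    (clique₁ a b (∈-++⁻ˡ T₁ T₂ u∈T) (∈-++⁻ˡ T₁ T₂ v∈T) (λ a≡b → u≢v (cong (_↑ˡ m) a≡b)))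
  ... | left a  | right b = ∨ᴳ-adj-↑ˡ-↑ʳ a b
  ... | right a | left b  = ∨ᴳ-adj-↑ʳ-↑ˡ a b
  ... | right a | right b = trans (∨ᴳ-adj-↑ʳ-↑ʳ a b)
    (clique₂ a b (∈-++⁻ʳ T₁ T₂ u∈T) (∈-++⁻ʳ T₁ T₂ v∈T) (λ a≡b → u≢v (cong (n ↑ʳ_) a≡b)))

  isClique-++⁻ : ∀ {T₁ T₂} → IsClique (G₁ ∨ᴳ G₂) (T₁ ++ T₂) →
                 IsClique G₁ T₁ × IsClique G₂ T₂
  isClique-++⁻ {T₁} {T₂} clique = clique₁ , clique₂
    where
    clique₁ : IsClique G₁ T₁
    clique₁ a b a∈T₁ b∈T₁ a≢b = trans (sym (∨ᴳ-adj-↑ˡ-↑ˡ a b))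
      (clique _ _ (∈-++⁺ˡ T₁ T₂ a∈T₁) (∈-++⁺ˡ T₁ T₂ b∈T₁) (λ eq → a≢b (↑ˡ-injective m a b eq)))
    clique₂ : IsClique G₂ T₂
    clique₂ a b a∈T₂ b∈T₂ a≢b = trans (sym (∨ᴳ-adj-↑ʳ-↑ʳ a b))
      (clique _ _ (∈-++⁺ʳ T₁ T₂ a∈T₂) (∈-++⁺ʳ T₁ T₂ b∈T₂) (λ eq → a≢b (↑ʳ-injective n a b eq)))

  isCliqueDeletionSet-++⁺ : ∀ {S₁ S₂} → IsCliqueDeletionSet G₁ S₁ → IsCliqueDeletionSet G₂ S₂ →
                            IsCliqueDeletionSet (G₁ ∨ᴳ G₂) (S₁ ++ S₂)
  isCliqueDeletionSet-++⁺ {S₁} {S₂} cds₁ cds₂ =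
    subst (IsClique (G₁ ∨ᴳ G₂)) (sym (∁-++ S₁ S₂)) (isClique-++⁺ cds₁ cds₂)

  isCliqueDeletionSet-++⁻ : ∀ {S₁ S₂} → IsCliqueDeletionSet (G₁ ∨ᴳ G₂) (S₁ ++ S₂) →
                            IsCliqueDeletionSet G₁ S₁ × IsCliqueDeletionSet G₂ S₂
  isCliqueDeletionSet-++⁻ {S₁} {S₂} cds =
    isClique-++⁻ (subst (IsClique (G₁ ∨ᴳ G₂)) (∁-++ S₁ S₂) cds)

  inducedConnected-++ : ∀ {S₁ S₂} → Nonempty S₁ → Nonempty S₂ →
                        InducedConnected (G₁ ∨ᴳ G₂) (S₁ ++ S₂)
  inducedConnected-++ {S₁} {S₂} (c₁ , c₁∈S₁) (c₂ , c₂∈S₂) u v u∈S v∈S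
    with joinView n m u | joinView n m v
  ... | left a  | left b  = step u∈S (∨ᴳ-adj-↑ˡ-↑ʳ a c₂)
    (step (∈-++⁺ʳ S₁ S₂ c₂∈S₂) (∨ᴳ-adj-↑ʳ-↑ˡ c₂ b) (here v∈S))
  ... | left a  | right b = step u∈S (∨ᴳ-adj-↑ˡ-↑ʳ a b) (here v∈S)
  ... | right a | left b  = step u∈S (∨ᴳ-adj-↑ʳ-↑ˡ a b) (here v∈S)
  ... | right a | right b = step u∈S (∨ᴳ-adj-↑ʳ-↑ˡ a c₁)
    (step (∈-++⁺ˡ S₁ S₂ c₁∈S₁) (∨ᴳ-adj-↑ˡ-↑ʳ c₁ b) (here v∈S))

  θ≡-∨ᴳ : ∀ {k₁ k₂} → θ≡ G₁ k₁ → θ≡ G₂ k₂ → θ≡ (G₁ ∨ᴳ G₂) (k₁ + k₂)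
  θ≡-∨ᴳ ((S₁ , cds₁ , refl) , min₁) ((S₂ , cds₂ , refl) , min₂) =
    (S₁ ++ S₂ , isCliqueDeletionSet-++⁺ cds₁ cds₂ , ∣p++q∣≡∣p∣+∣q∣ S₁ S₂) , minimal
    where
    minimal : ∀ S → IsCliqueDeletionSet (G₁ ∨ᴳ G₂) S → ∣ S₁ ∣ + ∣ S₂ ∣ ≤ ∣ S ∣
    minimal S cds with Vec.splitAt n S
    ... | T₁ , T₂ , refl =
      let cds₁ , cds₂ = isCliqueDeletionSet-++⁻ cds
      in subst (∣ S₁ ∣ + ∣ S₂ ∣ ≤_) (sym (∣p++q∣≡∣p∣+∣q∣ T₁ T₂))
               (+-mono-≤ (min₁ T₁ cds₁) (min₂ T₂ cds₂))

cliqueDeletionSet-nonempty : ∀ (G : Graph n) {S} → NonComplete G →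
                             IsCliqueDeletionSet G S → Nonempty S
cliqueDeletionSet-nonempty G {S} (u , v , u≢v , uv∉G) cds with u ∈? S | v ∈? S
... | yes u∈S | _       = u , u∈S
... | no _    | yes v∈S = v , v∈S
... | no u∉S  | no v∉S
  with () ← trans (sym uv∉G) (cds u v (x∉p⇒x∈∁p u∉S) (x∉p⇒x∈∁p v∉S) u≢v)

θ≡⇒θc≡ : ∀ {G : Graph n} {S} → θ≡ G k → IsConnectedCliqueDeletionSet G S → ∣ S ∣ ≡ k →
         θc≡ G k
θ≡⇒θc≡ {S = S} (_ , min) ccds ∣S∣≡k = (S , ccds , ∣S∣≡k) , λ T (cds , _) → min T cds

lemma22 : ∀ {n m} (G₁ : Graph n) (G₂ : Graph m) → NonComplete G₁ → NonComplete G₂ →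
    ∀ k₁ k₂ → θ≡ G₁ k₁ → θ≡ G₂ k₂ → θc≡ (G₁ ∨ᴳ G₂) (k₁ + k₂)
lemma22 G₁ G₂ nc₁ nc₂ _ _ θ₁@((S₁ , cds₁ , refl) , _) θ₂@((S₂ , cds₂ , refl) , _) =
  θ≡⇒θc≡ (θ≡-∨ᴳ G₁ G₂ θ₁ θ₂) (cds , connected) (∣p++q∣≡∣p∣+∣q∣ S₁ S₂)
  where
  cds : IsCliqueDeletionSet (G₁ ∨ᴳ G₂) (S₁ ++ S₂)
  cds = isCliqueDeletionSet-++⁺ G₁ G₂ cds₁ cds₂
  connected : InducedConnected (G₁ ∨ᴳ G₂) (S₁ ++ S₂)
  connected = inducedConnected-++ G₁ G₂
    (cliqueDeletionSet-nonempty G₁ nc₁ cds₁) (cliqueDeletionSet-nonempty G₂ nc₂ cds₂)
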